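{- For $n \in \{11,16,21,26,31\}$, let $C_n(1,3)$ be the graph with vertex set $\{v_0,\dots,v_{n-1}\}$ and edge set $\{v_iv_{i+1}\}_{0\le i\le n-1}\cup\{v_iv_{i+3}\}_{0\le i\le n-1}$, indices modulo $n$. Then $\chi''(C_n(1,3)) = 5$.
   Context: A total $k$-colouring of a simple graph $G$ is a map $\sigma: V(G)\cup E(G)\to\{1,\dots,k\}$ such that adjacent vertices receive distinct colours, adjacent edges receive distinct colours, and each vertex receives a colour different from those of its incident edges. $\chi''(G)$ is the least such $k$. -}

module Defs where

open import Data.Nat using (ℕ; _+_; _%_; _≤_; NonZero)
open import Data.Fin using (Fin; toℕ)
open import Data.Sum using (_⊎_)
open import Data.Product using (_×_)
open import Relation.Nullary using (¬_)
open import Relation.Binary.PropositionalEquality using (_≡_; _≢_)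

-- A simple graph on vertex set Fin n is given by its adjacency relation
-- (assumed symmetric and irreflexive; for C_n(1,3) with n ≥ 7 it is).
-- The edge uv is coloured by ec u v p (p a witness of adjacency); the colour
-- must not depend on orientation or on the witness.
record TotalColouring {n : ℕ} (Adj : Fin n → Fin n → Set) (k : ℕ) : Set where
  field
    vc    : Fin n → Fin k
    ec    : (u v : Fin n) → Adj u v → Fin k
    ec-wd : ∀ u v (p : Adj u v) (q : Adj v u) → ec u v p ≡ ec v u q
    vv    : ∀ u v → Adj u v → vc u ≢ vc v
    ee    : ∀ u v w (p : Adj u v) (q : Adj u w) → v ≢ w → ec u v p ≢ ec u w q
    ve    : ∀ u v (p : Adj u v) → vc u ≢ ec u v p

TotalChromaticNumberIs : {n : ℕ} → (Fin n → Fin n → Set) → ℕ → Set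
TotalChromaticNumberIs G k = TotalColouring G k × (∀ j → TotalColouring G j → k ≤ j)

StepAdj : (n : ℕ) → .{{NonZero n}} → ℕ → Fin n → Fin n → Set
StepAdj n d u v = (toℕ u + d) % n ≡ toℕ v

C13Adj : (n : ℕ) → .{{NonZero n}} → Fin n → Fin n → Set
C13Adj n u v = StepAdj n 1 u v ⊎ StepAdj n 1 v u ⊎ StepAdj n 3 u v ⊎ StepAdj n 3 v u

{-# OPTIONS --safe #-}
module Submission where

-- A vertex of degree Δ and its Δ incident edges need pairwise distinct colours, so
-- χ'' ≥ Δ + 1 = 5 for the 4-regular C_n(1,3). Conversely, for each n an explicit total
-- 5-colouring is given by three colour tables, and its validity is decided vertex by
-- vertex: every condition of a total colouring involves only edges at a common vertex.

open import Defs
open import Agda.Builtin.FromNat using (Number; fromNat)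
open import Data.Bool using (if_then_else_)
open import Data.Fin using (Fin; zero; suc; toℕ; _≟_)
open import Data.Fin.Literals using (number)
open import Data.Fin.Properties using (injective⇒≤; all?)
open import Data.List using (List; _∷_; length; lookup; filter; allFin)
open import Data.List.Membership.Propositional using (_∈_)
open import Data.List.Membership.Propositional.Properties using (∈-filter⁺; ∈-allFin; ∈-lookup)
open import Data.List.Relation.Unary.All as All using (All)
open import Data.List.Relation.Unary.All.Properties using (all-filter)
open import Data.List.Relation.Unary.AllPairs using (_∷_)
open import Data.List.Relation.Unary.Unique.Propositional using (Unique)
open import Data.List.Relation.Unary.Unique.Propositional.Properties using (filter⁺; allFin⁺)
open import Data.Nat as ℕ using (ℕ; suc; _+_; _%_; _≤_; NonZero)
import Data.Nat.Literals as ℕ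
open import Data.Product using (_×_; _,_; proj₁; proj₂)
open import Data.Sum using (_⊎_; fromInj₂)
open import Data.Unit using (tt)
open import Data.Vec as Vec using (Vec; _∷_; [])
open import Function.Definitions using (Injective)
open import Level using (Level)
open import Relation.Binary.Definitions using (Decidable)
open import Relation.Binary.PropositionalEquality using (_≡_; _≢_; refl; sym; cong)
open import Relation.Nullary using (Dec; ¬?; contradiction)
open import Relation.Nullary.Decidable using (True; toWitness; decidable-stable; ⌊_⌋; _×-dec_; _⊎-dec_)

-- Number literals for the colour tables; ℕ literals then need the instance tt : ⊤.
instance
  natNumber : Number ℕ
  natNumber = ℕ.number

  finNumber : ∀ {n} → Number (Fin n)
  finNumber = number _

private
  variable
    a : Level
    A : Set a

lookup-injective : {xs : List A} → Unique xs → Injective _≡_ _≡_ (lookup xs)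
lookup-injective {xs = _ ∷ _} _            {zero}  {zero}  _  = refl
lookup-injective {xs = _ ∷ _} (x∉xs ∷ _)   {zero}  {suc j} eq = contradiction eq (All.lookup x∉xs (∈-lookup j))
lookup-injective {xs = _ ∷ _} (x∉xs ∷ _)   {suc i} {zero}  eq = contradiction (sym eq) (All.lookup x∉xs (∈-lookup i))
lookup-injective {xs = _ ∷ _} (_ ∷ unique) {suc i} {suc j} eq = cong suc (lookup-injective unique eq)

module _ {n : ℕ} {Adj : Fin n → Fin n → Set} (adj? : Decidable Adj) where

  neighbours : Fin n → List (Fin n)
  neighbours u = filter (adj? u) (allFin n)

  degree : Fin n → ℕ
  degree u = length (neighbours u)

  adj⇒∈-neighbours : ∀ {u v} → Adj u v → v ∈ neighbours u
  adj⇒∈-neighbours {u} {v} = ∈-filter⁺ (adj? u) (∈-allFin v)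

  module _ {k : ℕ} (vc : Fin n → Fin k) (ec : Fin n → Fin n → Fin k) where

    ProperAt : Fin n → Set
    ProperAt u = All (λ v → ec u v ≡ ec v u × vc u ≢ vc v × vc u ≢ ec u v) (neighbours u)
               × All (λ v → All (λ w → v ≡ w ⊎ ec u v ≢ ec u w) (neighbours u)) (neighbours u)

    properAt? : ∀ u → Dec (ProperAt u)
    properAt? u =
      All.all? (λ v → ec u v ≟ ec v u ×-dec ¬? (vc u ≟ vc v) ×-dec ¬? (vc u ≟ ec u v)) (neighbours u)
      ×-dec All.all? (λ v → All.all? (λ w → v ≟ w ⊎-dec ¬? (ec u v ≟ ec u w)) (neighbours u)) (neighbours u)

    totalColouring : (∀ u → ProperAt u) → TotalColouring Adj k
    totalColouring proper = record
      { vc    = vc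
      ; ec    = λ u v _ → ec u v
      ; ec-wd = λ u v p _ → proj₁ (edge p)
      ; vv    = λ u v p → proj₁ (proj₂ (edge p))
      ; ee    = λ u v w p q v≢w → fromInj₂ (λ v≡w → contradiction v≡w v≢w) (incident p q)
      ; ve    = λ u v p → proj₂ (proj₂ (edge p))
      }
      where
      edge : ∀ {u v} → Adj u v → ec u v ≡ ec v u × vc u ≢ vc v × vc u ≢ ec u v
      edge {u} p = All.lookup (proj₁ (proper u)) (adj⇒∈-neighbours p)

      incident : ∀ {u v w} → Adj u v → Adj u w → v ≡ w ⊎ ec u v ≢ ec u w
      incident {u} p q = All.lookup (All.lookup (proj₂ (proper u)) (adj⇒∈-neighbours p)) (adj⇒∈-neighbours q)

  suc-degree≤ : ∀ {k} u → TotalColouring Adj k → suc (degree u) ≤ k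
  suc-degree≤ {k} u c = injective⇒≤ colour-injective
    where
    open TotalColouring c

    neighbour : Fin (degree u) → Fin n
    neighbour = lookup (neighbours u)

    adjacent : ∀ i → Adj u (neighbour i)
    adjacent i = All.lookup (all-filter (adj? u) (allFin n)) (∈-lookup i)

    colour : Fin (suc (degree u)) → Fin k
    colour zero    = vc u
    colour (suc i) = ec u (neighbour i) (adjacent i)

    colour-injective : Injective _≡_ _≡_ colour
    colour-injective {zero}  {zero}  _  = refl
    colour-injective {zero}  {suc j} eq = contradiction eq (ve u _ (adjacent j))
    colour-injective {suc i} {zero}  eq = contradiction (sym eq) (ve u _ (adjacent i))
    colour-injective {suc i} {suc j} eq = cong suc (lookup-injective (filter⁺ (adj? u) (allFin⁺ n))
      (decidable-stable (neighbour i ≟ neighbour j) (λ i≢j → ee u _ _ (adjacent i) (adjacent j) i≢j eq)))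

  totalChromaticNumberIs-suc-degree : ∀ {d} u → degree u ≡ d →
    TotalColouring Adj (suc d) → TotalChromaticNumberIs Adj (suc d)
  totalChromaticNumberIs-suc-degree u refl c = c , λ _ → suc-degree≤ u

module _ {n : ℕ} .{{_ : NonZero n}} where

  step? : ∀ d → Decidable (StepAdj n d)
  step? d u v = (toℕ u + d) % n ℕ.≟ toℕ v

  c13Adj? : Decidable (C13Adj n)
  c13Adj? u v = step? 1 u v ⊎-dec step? 1 v u ⊎-dec step? 3 u v ⊎-dec step? 3 v u

  -- edge₁ i colours v_i v_{i+1} and edge₃ i colours v_i v_{i+3}; non-edges get a junk colour.
  c13EdgeColour : ∀ {k} (edge₁ edge₃ : Fin n → Fin k) → Fin n → Fin n → Fin k
  c13EdgeColour edge₁ edge₃ u v =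
    if ⌊ step? 1 u v ⌋ then edge₁ u else
    if ⌊ step? 1 v u ⌋ then edge₁ v else
    if ⌊ step? 3 u v ⌋ then edge₃ u else edge₃ v

  c13Colouring : ∀ {k} (vertex edge₁ edge₃ : Vec (Fin k) n) →
    let ec = c13EdgeColour (Vec.lookup edge₁) (Vec.lookup edge₃) in
    True (all? (properAt? c13Adj? (Vec.lookup vertex) ec)) →
    TotalColouring (C13Adj n) k
  c13Colouring vertex edge₁ edge₃ proper = totalColouring c13Adj? _ _ (toWitness proper)

colouring₁₁ : TotalColouring (C13Adj 11) 5
colouring₁₁ = c13Colouring
  (3 ∷ 0 ∷ 4 ∷ 1 ∷ 4 ∷ 1 ∷ 2 ∷ 3 ∷ 4 ∷ 3 ∷ 1 ∷ [])
  (2 ∷ 1 ∷ 2 ∷ 0 ∷ 2 ∷ 4 ∷ 0 ∷ 2 ∷ 0 ∷ 2 ∷ 0 ∷ [])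
  (4 ∷ 3 ∷ 0 ∷ 3 ∷ 1 ∷ 3 ∷ 1 ∷ 4 ∷ 1 ∷ 4 ∷ 3 ∷ [])
  _

colouring₁₆ : TotalColouring (C13Adj 16) 5
colouring₁₆ = c13Colouring
  (1 ∷ 4 ∷ 3 ∷ 2 ∷ 0 ∷ 1 ∷ 0 ∷ 3 ∷ 2 ∷ 1 ∷ 2 ∷ 0 ∷ 4 ∷ 0 ∷ 1 ∷ 2 ∷ [])
  (2 ∷ 1 ∷ 0 ∷ 1 ∷ 4 ∷ 3 ∷ 1 ∷ 4 ∷ 3 ∷ 4 ∷ 3 ∷ 2 ∷ 3 ∷ 2 ∷ 3 ∷ 0 ∷ [])
  (3 ∷ 3 ∷ 2 ∷ 4 ∷ 2 ∷ 0 ∷ 2 ∷ 0 ∷ 1 ∷ 0 ∷ 1 ∷ 4 ∷ 1 ∷ 4 ∷ 0 ∷ 4 ∷ [])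
  _

colouring₂₁ : TotalColouring (C13Adj 21) 5
colouring₂₁ = c13Colouring
  (0 ∷ 2 ∷ 4 ∷ 2 ∷ 1 ∷ 0 ∷ 3 ∷ 0 ∷ 2 ∷ 1 ∷ 2 ∷ 1 ∷ 4 ∷ 3 ∷ 0 ∷ 2 ∷ 1 ∷ 4 ∷ 1 ∷ 0 ∷ 3 ∷ [])
  (4 ∷ 3 ∷ 1 ∷ 4 ∷ 3 ∷ 4 ∷ 1 ∷ 4 ∷ 0 ∷ 4 ∷ 0 ∷ 2 ∷ 0 ∷ 2 ∷ 3 ∷ 0 ∷ 3 ∷ 0 ∷ 3 ∷ 4 ∷ 1 ∷ [])
  (3 ∷ 0 ∷ 2 ∷ 0 ∷ 2 ∷ 1 ∷ 2 ∷ 3 ∷ 3 ∷ 3 ∷ 1 ∷ 4 ∷ 1 ∷ 4 ∷ 1 ∷ 4 ∷ 2 ∷ 2 ∷ 2 ∷ 1 ∷ 0 ∷ [])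
  _

colouring₂₆ : TotalColouring (C13Adj 26) 5
colouring₂₆ = c13Colouring
  (4 ∷ 1 ∷ 2 ∷ 3 ∷ 4 ∷ 3 ∷ 0 ∷ 2 ∷ 0 ∷ 2 ∷ 3 ∷ 2 ∷ 1 ∷ 0 ∷ 3 ∷ 4 ∷ 2 ∷ 1 ∷ 0 ∷ 3 ∷ 2 ∷ 4 ∷ 1 ∷ 0 ∷ 3 ∷ 0 ∷ [])
  (0 ∷ 3 ∷ 4 ∷ 0 ∷ 1 ∷ 4 ∷ 1 ∷ 4 ∷ 1 ∷ 4 ∷ 1 ∷ 4 ∷ 3 ∷ 4 ∷ 1 ∷ 0 ∷ 3 ∷ 4 ∷ 2 ∷ 1 ∷ 3 ∷ 2 ∷ 3 ∷ 1 ∷ 2 ∷ 3 ∷ [])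
  (1 ∷ 2 ∷ 0 ∷ 2 ∷ 3 ∷ 2 ∷ 3 ∷ 0 ∷ 3 ∷ 0 ∷ 2 ∷ 0 ∷ 2 ∷ 1 ∷ 2 ∷ 3 ∷ 4 ∷ 0 ∷ 1 ∷ 0 ∷ 4 ∷ 0 ∷ 4 ∷ 2 ∷ 4 ∷ 1 ∷ [])
  _

colouring₃₁ : TotalColouring (C13Adj 31) 5
colouring₃₁ = c13Colouring
  (4 ∷ 0 ∷ 2 ∷ 0 ∷ 1 ∷ 3 ∷ 4 ∷ 2 ∷ 0 ∷ 2 ∷ 0 ∷ 1 ∷ 3 ∷ 1 ∷ 0 ∷ 4 ∷ 2 ∷ 3 ∷ 1 ∷ 0 ∷ 1 ∷ 0 ∷ 3 ∷ 0 ∷ 4 ∷ 1 ∷ 4 ∷ 1 ∷ 2 ∷ 3 ∷ 0 ∷ [])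
  (3 ∷ 1 ∷ 4 ∷ 3 ∷ 4 ∷ 2 ∷ 3 ∷ 4 ∷ 3 ∷ 4 ∷ 3 ∷ 0 ∷ 4 ∷ 3 ∷ 1 ∷ 3 ∷ 1 ∷ 4 ∷ 3 ∷ 2 ∷ 3 ∷ 4 ∷ 2 ∷ 3 ∷ 2 ∷ 3 ∷ 2 ∷ 3 ∷ 1 ∷ 2 ∷ 1 ∷ [])
  (2 ∷ 2 ∷ 0 ∷ 1 ∷ 0 ∷ 1 ∷ 0 ∷ 1 ∷ 2 ∷ 1 ∷ 2 ∷ 4 ∷ 2 ∷ 0 ∷ 2 ∷ 0 ∷ 4 ∷ 0 ∷ 2 ∷ 1 ∷ 4 ∷ 1 ∷ 0 ∷ 1 ∷ 0 ∷ 4 ∷ 0 ∷ 4 ∷ 0 ∷ 4 ∷ 3 ∷ [])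
  _

lemma4 : TotalChromaticNumberIs (C13Adj 11) 5
    × TotalChromaticNumberIs (C13Adj 16) 5
    × TotalChromaticNumberIs (C13Adj 21) 5
    × TotalChromaticNumberIs (C13Adj 26) 5
    × TotalChromaticNumberIs (C13Adj 31) 5
lemma4 =
  totalChromaticNumberIs-suc-degree c13Adj? zero refl colouring₁₁ ,
  totalChromaticNumberIs-suc-degree c13Adj? zero refl colouring₁₆ ,
  totalChromaticNumberIs-suc-degree c13Adj? zero refl colouring₂₁ ,
  totalChromaticNumberIs-suc-degree c13Adj? zero refl colouring₂₆ ,
  totalChromaticNumberIs-suc-degree c13Adj? zero refl colouring₃₁
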